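{- For every set $X$ and all $a,b\in\mathscr{A}^X$: $[\![a_x\to b_x]\!]'_{x\in X}=[\![a]\!]'_X\to[\![b]\!]'_X$ in $\mathsf{P}X$.
   Context: $\mathsf{P}:\mathbf{Set}^{\mathrm{op}}\to\mathbf{HA}$ is a $\mathbf{Set}$-based tripos: a functor into Heyting algebras such that (1) each $\mathsf{P}f:\mathsf{P}Y\to\mathsf{P}X$ ($f:X\to Y$) has a left adjoint $\exists f$ and right adjoint $\forall f$ among monotone maps $\mathsf{P}X\to\mathsf{P}Y$; (2) for every pullback square in $\mathbf{Set}$ with $f_1:X\to X_1,f_2:X\to X_2,g_1:X_1\to Y,g_2:X_2\to Y$, $\exists f_1\circ\mathsf{P}f_2=\mathsf{P}g_1\circ\exists g_2$ and $\forall f_1\circ\mathsf{P}f_2=\mathsf{P}g_1\circ\forall g_2$; (3) there is a set $\Sigma$ and $\mathrm{tr}_\Sigma\in\mathsf{P}\Sigma$ with $\sigma\mapsto\mathsf{P}\sigma(\mathrm{tr}_\Sigma)$, $\Sigma^X\to\mathsf{P}X$, surjective for every set $X$. Fix these; for $\sigma\in\Sigma^X$ write $[\![\sigma]\!]_X:=\mathsf{P}\sigma(\mathrm{tr}_\Sigma)$. Let $\pi,\pi'$ be the projections $\Sigma\times\Sigma\to\Sigma$ and $\dot\to:\Sigma\times\Sigma\to\Sigma$ (infix) any map with $[\![\dot\to]\!]_{\Sigma\times\Sigma}=[\![\pi]\!]_{\Sigma\times\Sigma}\to[\![\pi']\!]_{\Sigma\times\Sigma}$. Let $E=\{(\xi,s)\in\Sigma\times\mathfrak{P}(\Sigma):\xi\in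 s\}$ with projections $e_1,e_2$, and $\dot\bigwedge:\mathfrak{P}(\Sigma)\to\Sigma$ any map with $[\![\dot\bigwedge]\!]_{\mathfrak{P}(\Sigma)}=\forall e_2([\![e_1]\!]_E)$. Let $\mathscr{A}_0$ be the set of atoms inductively generated by: an atom $\dot\xi$ for each $\xi\in\Sigma$, and an atom $(s\mapsto\alpha)$ for each $s\subseteq\Sigma$, $\alpha\in\mathscr{A}_0$. The preorder $\le$ on $\mathscr{A}_0$ is inductively generated by $\dot\xi\le\dot\xi$ and: $s\subseteq s'$, $\alpha\le\alpha'$ imply $(s\mapsto\alpha)\le(s'\mapsto\alpha')$. Define $\phi_0:\mathscr{A}_0\to\Sigma$ by $\phi_0(\dot\xi)=\xi$, $\phi_0(s\mapsto\alpha)=(\dot\bigwedge s)\mathbin{\dot\to}\phi_0(\alpha)$. Let $\mathscr{A}$ be the set of upward closed subsets of $(\mathscr{A}_0,\le)$. For $a\in\mathscr{A}$ let $\tilde\phi_0(a)=\{\phi_0(\alpha):\alpha\in a\}$ and for $a,b\in\mathscr{A}$ let $a\to b=\{s\mapsto\beta:s\subseteq\Sigma,\ \tilde\phi_0(a)\subseteq s,\ \beta\in b\}$. Define $\phi:\mathscr{A}\to\Sigma$ by $\phi(a)=\dot\bigwedge\tilde\phi_0(a)$, $\mathrm{tr}_{\mathscr{A}}:=\mathsf{P}\phi(\mathrm{tr}_\Sigma)\in\mathsf{P}\mathscr{A}$, and for $a\in\mathscr{A}^X$, $[\![a]\!]'_X=[\![a_x]\!]'_{x\in X}:=\mathsf{P}a(\mathrm{tr}_{\mathscr{A}})$.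 The axiom of choice is assumed. -}

module Defs where

open import Level using (Level; _⊔_) renaming (suc to lsuc)
open import Data.Bool using (Bool; true; false; _∧_)
open import Data.Product using (Σ; _×_; _,_; proj₁; proj₂; ∃; ∃!)
open import Relation.Binary.PropositionalEquality using (_≡_; refl; _≗_)
open import Relation.Nullary using (Dec; yes; no; does)
open import Relation.Binary.Lattice.Bundles using (HeytingAlgebra)
open import Function using (_∘_; id)

IsPullback : {X X₁ X₂ Y : Set} (f₁ : X → X₁) (f₂ : X → X₂)
             (g₁ : X₁ → Y) (g₂ : X₂ → Y) → Set
IsPullback {X} f₁ f₂ g₁ g₂ =
  (∀ x → g₁ (f₁ x) ≡ g₂ (f₂ x)) ×
  (∀ x₁ x₂ → g₁ x₁ ≡ g₂ x₂ → ∃! {A = X} _≡_ (λ x → f₁ x ≡ x₁ × f₂ x ≡ x₂))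

module _ {c ℓ₁ ℓ₂ : Level} (𝒫 : Set → HeytingAlgebra c ℓ₁ ℓ₂) where
  Car : Set → Set c
  Car X = HeytingAlgebra.Carrier (𝒫 X)

record Tripos (c ℓ₁ ℓ₂ : Level) : Set (lsuc (c ⊔ ℓ₁ ⊔ ℓ₂)) where
  field
    𝒫 : Set → HeytingAlgebra c ℓ₁ ℓ₂
    P : {X Y : Set} → (X → Y) → Car 𝒫 Y → Car 𝒫 X
  module H (X : Set) = HeytingAlgebra (𝒫 X)
  field
    P-cong : ∀ {X Y} (f : X → Y) {φ ψ} → H._≈_ Y φ ψ → H._≈_ X (P f φ) (P f ψ)
    P-mono : ∀ {X Y} (f : X → Y) {φ ψ} → H._≤_ Y φ ψ → H._≤_ X (P f φ) (P f ψ)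
    P-∧ : ∀ {X Y} (f : X → Y) φ ψ → H._≈_ X (P f (H._∧_ Y φ ψ)) (H._∧_ X (P f φ) (P f ψ))
    P-∨ : ∀ {X Y} (f : X → Y) φ ψ → H._≈_ X (P f (H._∨_ Y φ ψ)) (H._∨_ X (P f φ) (P f ψ))
    P-⇨ : ∀ {X Y} (f : X → Y) φ ψ → H._≈_ X (P f (H._⇨_ Y φ ψ)) (H._⇨_ X (P f φ) (P f ψ))
    P-⊤ : ∀ {X Y} (f : X → Y) → H._≈_ X (P f (H.⊤ Y)) (H.⊤ X)
    P-⊥ : ∀ {X Y} (f : X → Y) → H._≈_ X (P f (H.⊥ Y)) (H.⊥ X)
    -- functoriality (Set^op → HA); maps of Set are identified extensionally
    P-id : ∀ {X} φ → H._≈_ X (P (id {A = X}) φ) φ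
    P-∘ : ∀ {X Y Z} (f : X → Y) (g : Y → Z) φ → H._≈_ X (P (g ∘ f) φ) (P f (P g φ))
    P-ext : ∀ {X Y} {f g : X → Y} → f ≗ g → ∀ φ → H._≈_ X (P f φ) (P g φ)
    ∃P ∀P : {X Y : Set} → (X → Y) → Car 𝒫 X → Car 𝒫 Y
    ∃P-mono : ∀ {X Y} (f : X → Y) {φ ψ} → H._≤_ X φ ψ → H._≤_ Y (∃P f φ) (∃P f ψ)
    ∀P-mono : ∀ {X Y} (f : X → Y) {φ ψ} → H._≤_ X φ ψ → H._≤_ Y (∀P f φ) (∀P f ψ)
    ∃P-adj₁ : ∀ {X Y} (f : X → Y) φ ψ → H._≤_ Y (∃P f φ) ψ → H._≤_ X φ (P f ψ)
    ∃P-adj₂ : ∀ {X Y} (f : X → Y) φ ψ → H._≤_ X φ (P f ψ) → H._≤_ Y (∃P f φ) ψ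
    ∀P-adj₁ : ∀ {X Y} (f : X → Y) ψ φ → H._≤_ X (P f ψ) φ → H._≤_ Y ψ (∀P f φ)
    ∀P-adj₂ : ∀ {X Y} (f : X → Y) ψ φ → H._≤_ Y ψ (∀P f φ) → H._≤_ X (P f ψ) φ
    BC-∃ : ∀ {X X₁ X₂ Y} (f₁ : X → X₁) (f₂ : X → X₂) (g₁ : X₁ → Y) (g₂ : X₂ → Y) →
           IsPullback f₁ f₂ g₁ g₂ → ∀ φ →
           H._≈_ X₁ (∃P f₁ (P f₂ φ)) (P g₁ (∃P g₂ φ))
    BC-∀ : ∀ {X X₁ X₂ Y} (f₁ : X → X₁) (f₂ : X → X₂) (g₁ : X₁ → Y) (g₂ : X₂ → Y) →
           IsPullback f₁ f₂ g₁ g₂ → ∀ φ →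
           H._≈_ X₁ (∀P f₁ (P f₂ φ)) (P g₁ (∀P g₂ φ))
    Sig : Set
    tr : Car 𝒫 Sig
    generic : ∀ {X} (φ : Car 𝒫 X) → ∃ λ (σ : X → Sig) → H._≈_ X (P σ tr) φ

-- The construction.  Subsets are Bool-valued (classical powerset); the
-- classical metatheory is provided by the excluded-middle oracle `lem`.

module Construction {c ℓ₁ ℓ₂ : Level} (T : Tripos c ℓ₁ ℓ₂)
                    (lem : (A : Set) → Dec A) where
  open Tripos T

  ⟦_⟧ : {X : Set} → (X → Sig) → Car 𝒫 X
  ⟦ σ ⟧ = P σ tr

  𝔓 : Set
  𝔓 = Sig → Bool

  _∈_ : Sig → 𝔓 → Set
  ξ ∈ s = s ξ ≡ true

  _⊆_ : 𝔓 → 𝔓 → Set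
  s ⊆ s' = ∀ ξ → ξ ∈ s → ξ ∈ s'

  π π' : Sig × Sig → Sig
  π = proj₁
  π' = proj₂

  IsImp : (Sig × Sig → Sig) → Set ℓ₁
  IsImp imp = H._≈_ (Sig × Sig) ⟦ imp ⟧ (H._⇨_ (Sig × Sig) ⟦ π ⟧ ⟦ π' ⟧)

  E : Set
  E = Σ (Sig × 𝔓) (λ p → proj₁ p ∈ proj₂ p)

  e₁ : E → Sig
  e₁ p = proj₁ (proj₁ p)

  e₂ : E → 𝔓
  e₂ p = proj₂ (proj₁ p)

  IsMeet : (𝔓 → Sig) → Set ℓ₁
  IsMeet mt = H._≈_ 𝔓 ⟦ mt ⟧ (∀P e₂ ⟦ e₁ ⟧)

  infixr 5 _↦_
  data 𝒜₀ : Set where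
    dot : Sig → 𝒜₀
    _↦_ : 𝔓 → 𝒜₀ → 𝒜₀

  data _≤₀_ : 𝒜₀ → 𝒜₀ → Set where
    dot≤ : ∀ ξ → dot ξ ≤₀ dot ξ
    ↦≤   : ∀ {s s' α α'} → s ⊆ s' → α ≤₀ α' → (s ↦ α) ≤₀ (s' ↦ α')

  UpClosed : (𝒜₀ → Bool) → Set
  UpClosed u = ∀ {α β} → α ≤₀ β → u α ≡ true → u β ≡ true

  𝒜 : Set
  𝒜 = Σ (𝒜₀ → Bool) UpClosed

  module Ops (imp : Sig × Sig → Sig) (mt : 𝔓 → Sig) where

    φ₀ : 𝒜₀ → Sig
    φ₀ (dot ξ) = ξ
    φ₀ (s ↦ α) = imp (mt s , φ₀ α)

    φ̃₀ : 𝒜 → 𝔓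
    φ̃₀ a ξ = does (lem (∃ λ α → proj₁ a α ≡ true × φ₀ α ≡ ξ))

    ⇒fun : 𝒜 → 𝒜 → 𝒜₀ → Bool
    ⇒fun a b (dot ξ) = false
    ⇒fun a b (s ↦ β) = does (lem (φ̃₀ a ⊆ s)) ∧ proj₁ b β

    ⇒up : ∀ a b → UpClosed (⇒fun a b)
    ⇒up a b (dot≤ ξ) h = h
    ⇒up a b (↦≤ {s} {s'} {β} {β'} s⊆s' β≤β') h
      with lem (φ̃₀ a ⊆ s) | lem (φ̃₀ a ⊆ s')
    ... | yes p | yes q = proj₂ b β≤β' h
    ... | yes p | no ¬q = Data.Empty.⊥-elim (¬q (λ ξ m → s⊆s' ξ (p ξ m)))
      where import Data.Empty
    ... | no ¬p | _ with h
    ... | ()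

    _⇒_ : 𝒜 → 𝒜 → 𝒜
    a ⇒ b = ⇒fun a b , ⇒up a b

    φ : 𝒜 → Sig
    φ a = mt (φ̃₀ a)

    tr𝒜 : Car 𝒫 𝒜
    tr𝒜 = P φ tr

    ⟦_⟧' : {X : Set} → (X → 𝒜) → Car 𝒫 X
    ⟦ a ⟧' = P a tr𝒜

-- Writing ⋀ s for the generic meet of s ⊆ Σ, [[⋀ u]] is the universal quantification of the
-- generic predicate along the membership relation of u, so it obeys the introduction and
-- elimination rules of a meet in P X.  Since φ̃₀(a → b) = { ⋀ s →̇ ξ ∣ φ̃₀(a) ⊆ s, ξ ∈ φ̃₀(b) },
-- both inequalities between [[a → b]]' and [[a]]' ⇨ [[b]]' then reduce to modus ponens:
-- one instance uses s = φ̃₀(a), the other that ⋀ is antitone.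
module Submission where

open import Level using (Level)
open import Data.Bool using (true; _∧_)
open import Data.Empty using (⊥-elim)
open import Data.Product using (_×_; _,_; proj₁; ∃!)
open import Function using (_∘_)
open import Relation.Nullary using (Dec; yes; no; does)
open import Relation.Binary.PropositionalEquality using (_≡_; refl)
open import Relation.Binary.Lattice.Bundles using (HeytingAlgebra)
import Relation.Binary.Lattice.Properties.HeytingAlgebra as HeytingAlgebraProperties
import Relation.Binary.Reasoning.PartialOrder as PosetReasoning

open import Defs

module _ {c ℓ₁ ℓ₂ : Level} (T : Tripos c ℓ₁ ℓ₂) (lem : (A : Set) → Dec A) where
  open Tripos T
  open Construction T lem

  module HP (X : Set) = HeytingAlgebraProperties (𝒫 X)
  module ≤-Reasoning (X : Set) = PosetReasoning (H.poset X)

  does-lem-true : {A : Set} → A → does (lem A) ≡ true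
  does-lem-true {A} x with lem A
  ... | yes _ = refl
  ... | no ¬x = ⊥-elim (¬x x)

  does-lem-true⁻¹ : {A : Set} → does (lem A) ≡ true → A
  does-lem-true⁻¹ {A} h with lem A
  ... | yes x = x
  does-lem-true⁻¹ () | no _

  ∀P-cong : ∀ {X Y} (f : X → Y) {φ ψ} → H._≈_ X φ ψ → H._≈_ Y (∀P f φ) (∀P f ψ)
  ∀P-cong {X} {Y} f φ≈ψ =
    H.antisym Y (∀P-mono f (H.reflexive X φ≈ψ)) (∀P-mono f (H.reflexive X (H.Eq.sym X φ≈ψ)))

  ⟦imp⟧≈⇨ : (imp : Sig × Sig → Sig) → IsImp imp → ∀ {W} (f g : W → Sig) →
            H._≈_ W ⟦ (λ w → imp (f w , g w)) ⟧ (H._⇨_ W ⟦ f ⟧ ⟦ g ⟧)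
  ⟦imp⟧≈⇨ imp imp-spec {W} f g = begin-equality
    P (imp ∘ ⟨f,g⟩) tr                        ≈⟨ P-∘ ⟨f,g⟩ imp tr ⟩
    P ⟨f,g⟩ ⟦ imp ⟧                           ≈⟨ P-cong ⟨f,g⟩ imp-spec ⟩
    P ⟨f,g⟩ (H._⇨_ (Sig × Sig) ⟦ π ⟧ ⟦ π' ⟧)  ≈⟨ P-⇨ ⟨f,g⟩ _ _ ⟩
    H._⇨_ W (P ⟨f,g⟩ ⟦ π ⟧) (P ⟨f,g⟩ ⟦ π' ⟧)
      ≈⟨ HP.⇨-cong W (H.Eq.sym W (P-∘ ⟨f,g⟩ π tr)) (H.Eq.sym W (P-∘ ⟨f,g⟩ π' tr)) ⟩
    H._⇨_ W ⟦ f ⟧ ⟦ g ⟧                       ∎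
    where
    open ≤-Reasoning W
    ⟨f,g⟩ : W → Sig × Sig
    ⟨f,g⟩ w = f w , g w

  record Mem {Z : Set} (u : Z → 𝔓) : Set where
    constructor mem
    field
      index   : Z
      member  : Sig
      member∈ : member ∈ u index
  open Mem

  Mem→E : ∀ {Z} (u : Z → 𝔓) → Mem u → E
  Mem→E u y = (member y , u (index y)) , member∈ y

  Mem-pullback : ∀ {Z} (u : Z → 𝔓) → IsPullback index (Mem→E u) u e₂
  Mem-pullback u = (λ _ → refl) , unique
    where
    unique : ∀ z e → u z ≡ e₂ e → ∃! _≡_ λ y → index y ≡ z × Mem→E u y ≡ e
    unique z ((ξ , .(u z)) , ξ∈) refl = mem z ξ ξ∈ , (refl , refl) , λ where (refl , refl) → refl

  module Meet (mt : 𝔓 → Sig) (mt-spec : IsMeet mt) where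

    ⟦⋀_⟧ : ∀ {Z} → (Z → 𝔓) → Car 𝒫 Z
    ⟦⋀ u ⟧ = ⟦ mt ∘ u ⟧

    ⟦⋀⟧≈∀P : ∀ {Z} (u : Z → 𝔓) → H._≈_ Z ⟦⋀ u ⟧ (∀P index ⟦ member {u = u} ⟧)
    ⟦⋀⟧≈∀P {Z} u = begin-equality
      P (mt ∘ u) tr                        ≈⟨ P-∘ u mt tr ⟩
      P u ⟦ mt ⟧                           ≈⟨ P-cong u mt-spec ⟩
      P u (∀P e₂ ⟦ e₁ ⟧)                   ≈⟨ BC-∀ index (Mem→E u) u e₂ (Mem-pullback u) ⟦ e₁ ⟧ ⟨
      ∀P index (P (Mem→E u) ⟦ e₁ ⟧)        ≈⟨ ∀P-cong index (P-∘ (Mem→E u) e₁ tr) ⟨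
      ∀P index ⟦ member ⟧                  ∎
      where open ≤-Reasoning Z

    ≤-⟦⋀⟧ : ∀ {Z} (u : Z → 𝔓) (ψ : Car 𝒫 Z) →
            H._≤_ (Mem u) (P index ψ) ⟦ member ⟧ → H._≤_ Z ψ ⟦⋀ u ⟧
    ≤-⟦⋀⟧ {Z} u ψ Pψ≤ = begin
      ψ                    ≤⟨ ∀P-adj₁ index ψ _ Pψ≤ ⟩
      ∀P index ⟦ member ⟧  ≈⟨ ⟦⋀⟧≈∀P u ⟨
      ⟦⋀ u ⟧               ∎
      where open ≤-Reasoning Z

    ⟦⋀⟧-≤ : ∀ {Z W} (u : Z → 𝔓) (w : W → Z) (k : W → Sig) → (∀ v → k v ∈ u (w v)) →
            H._≤_ W (P w ⟦⋀ u ⟧) ⟦ k ⟧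
    ⟦⋀⟧-≤ {Z} {W} u w k k∈ = begin
      P w ⟦⋀ u ⟧                               ≈⟨ P-cong w (⟦⋀⟧≈∀P u) ⟩
      P w (∀P index ⟦ member ⟧)                ≈⟨ P-∘ ⟨w,k⟩ index _ ⟩
      P ⟨w,k⟩ (P index (∀P index ⟦ member ⟧))  ≤⟨ P-mono ⟨w,k⟩ (∀P-adj₂ index _ _ (H.refl Z)) ⟩
      P ⟨w,k⟩ ⟦ member ⟧                       ≈⟨ P-∘ ⟨w,k⟩ member tr ⟨
      ⟦ k ⟧                                    ∎
      where
      open ≤-Reasoning W
      ⟨w,k⟩ : W → Mem u
      ⟨w,k⟩ v = mem (w v) (k v) (k∈ v)

    ⟦⋀⟧-antitone : ∀ {Z} (u u' : Z → 𝔓) → (∀ z → u z ⊆ u' z) → H._≤_ Z ⟦⋀ u' ⟧ ⟦⋀ u ⟧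
    ⟦⋀⟧-antitone u u' u⊆u' =
      ≤-⟦⋀⟧ u _ (⟦⋀⟧-≤ u' index member λ y → u⊆u' (index y) (member y) (member∈ y))

  module _ (imp : Sig × Sig → Sig) (imp-spec : IsImp imp)
           (mt : 𝔓 → Sig) (mt-spec : IsMeet mt) where
    open Ops imp mt
    open Meet mt mt-spec

    record ⇒-Witness (a b : 𝒜) (ζ : Sig) : Set where
      constructor witness
      field
        premise    : 𝔓
        conclusion : Sig
        φ̃₀a⊆premise : φ̃₀ a ⊆ premise
        conclusion∈ : conclusion ∈ φ̃₀ b
        ≡ζ          : imp (mt premise , conclusion) ≡ ζ
    open ⇒-Witness

    ∈-φ̃₀-⇒ : ∀ a b {ξ} → ξ ∈ φ̃₀ b → imp (φ a , ξ) ∈ φ̃₀ (a ⇒ b)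
    ∈-φ̃₀-⇒ a b ξ∈ with does-lem-true⁻¹ ξ∈
    ... | β , β∈b , refl = does-lem-true ((φ̃₀ a ↦ β) , φ̃₀a↦β∈ , refl)
      where
      φ̃₀a↦β∈ : does (lem (φ̃₀ a ⊆ φ̃₀ a)) ∧ proj₁ b β ≡ true
      φ̃₀a↦β∈ rewrite does-lem-true {φ̃₀ a ⊆ φ̃₀ a} (λ _ ξ∈ → ξ∈) = β∈b

    ∈-φ̃₀-⇒⁻¹ : ∀ a b {ζ} → ζ ∈ φ̃₀ (a ⇒ b) → ⇒-Witness a b ζ
    ∈-φ̃₀-⇒⁻¹ a b ζ∈ with does-lem-true⁻¹ ζ∈
    ... | dot _ , () , _
    ... | (s ↦ β) , s↦β∈ , refl with lem (φ̃₀ a ⊆ s) | s↦β∈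
    ...   | yes φ̃₀a⊆s | β∈b = witness s (φ₀ β) φ̃₀a⊆s (does-lem-true (β , β∈b , refl)) refl
    ...   | no _       | ()

    module _ {X : Set} (a b : X → 𝒜) where
      private
        A B C : X → 𝔓
        A x = φ̃₀ (a x)
        B x = φ̃₀ (b x)
        C x = φ̃₀ (a x ⇒ b x)

      ⟦⋀⇒⟧≤⇨ : H._≤_ X ⟦⋀ C ⟧ (H._⇨_ X ⟦⋀ A ⟧ ⟦⋀ B ⟧)
      ⟦⋀⇒⟧≤⇨ = H.transpose-⇨ X (≤-⟦⋀⟧ B _
        (H.trans (Mem B) (H.reflexive (Mem B) (P-∧ index _ _)) (H.transpose-∧ (Mem B) modus-ponens)))
        where
        open ≤-Reasoning (Mem B)
        modus-ponens : H._≤_ (Mem B) (P index ⟦⋀ C ⟧) (H._⇨_ (Mem B) (P index ⟦⋀ A ⟧) ⟦ member ⟧)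
        modus-ponens = begin
          P index ⟦⋀ C ⟧
            ≤⟨ ⟦⋀⟧-≤ C index (λ y → imp (φ (a (index y)) , member y))
                 (λ y → ∈-φ̃₀-⇒ (a (index y)) (b (index y)) (member∈ y)) ⟩
          ⟦ (λ y → imp (φ (a (index y)) , member y)) ⟧
            ≈⟨ ⟦imp⟧≈⇨ imp imp-spec (φ ∘ a ∘ index) member ⟩
          H._⇨_ (Mem B) ⟦ φ ∘ a ∘ index ⟧ ⟦ member ⟧
            ≈⟨ HP.⇨-cong (Mem B) (P-∘ index (φ ∘ a) tr) (H.Eq.refl (Mem B)) ⟩
          H._⇨_ (Mem B) (P index ⟦⋀ A ⟧) ⟦ member ⟧ ∎

      ⇨≤⟦⋀⇒⟧ : H._≤_ X (H._⇨_ X ⟦⋀ A ⟧ ⟦⋀ B ⟧) ⟦⋀ C ⟧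
      ⇨≤⟦⋀⇒⟧ = ≤-⟦⋀⟧ C _ (begin
        P index (H._⇨_ X ⟦⋀ A ⟧ ⟦⋀ B ⟧)               ≈⟨ P-⇨ index _ _ ⟩
        H._⇨_ (Mem C) (P index ⟦⋀ A ⟧) (P index ⟦⋀ B ⟧) ≤⟨ HP.⇨-relax (Mem C) ⟦⋀premise⟧≤ ⟦⋀B⟧≤ ⟩
        H._⇨_ (Mem C) ⟦⋀ premise ∘ w ⟧ ⟦ conclusion ∘ w ⟧ ≈⟨ ⟦imp⟧≈⇨ imp imp-spec _ _ ⟨
        ⟦ (λ y → imp (mt (premise (w y)) , conclusion (w y))) ⟧ ≈⟨ P-ext (≡ζ ∘ w) tr ⟩
        ⟦ member ⟧                                     ∎)
        where
        open ≤-Reasoning (Mem C)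
        w : (y : Mem C) → ⇒-Witness (a (index y)) (b (index y)) (member y)
        w y = ∈-φ̃₀-⇒⁻¹ (a (index y)) (b (index y)) (member∈ y)
        ⟦⋀premise⟧≤ : H._≤_ (Mem C) ⟦⋀ premise ∘ w ⟧ (P index ⟦⋀ A ⟧)
        ⟦⋀premise⟧≤ = begin
          ⟦⋀ premise ∘ w ⟧  ≤⟨ ⟦⋀⟧-antitone (A ∘ index) (premise ∘ w) (φ̃₀a⊆premise ∘ w) ⟩
          ⟦⋀ A ∘ index ⟧    ≈⟨ P-∘ index (mt ∘ A) tr ⟩
          P index ⟦⋀ A ⟧    ∎
        ⟦⋀B⟧≤ : H._≤_ (Mem C) (P index ⟦⋀ B ⟧) ⟦ conclusion ∘ w ⟧
        ⟦⋀B⟧≤ = ⟦⋀⟧-≤ B index (conclusion ∘ w) (conclusion∈ ∘ w)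

      ⟦⇒⟧'≈⇨ : H._≈_ X ⟦ (λ x → a x ⇒ b x) ⟧' (H._⇨_ X ⟦ a ⟧' ⟦ b ⟧')
      ⟦⇒⟧'≈⇨ = begin-equality
        ⟦ (λ x → a x ⇒ b x) ⟧'  ≈⟨ P-∘ _ φ tr ⟨
        ⟦⋀ C ⟧                  ≈⟨ H.antisym X ⟦⋀⇒⟧≤⇨ ⇨≤⟦⋀⇒⟧ ⟩
        H._⇨_ X ⟦⋀ A ⟧ ⟦⋀ B ⟧   ≈⟨ HP.⇨-cong X (P-∘ a φ tr) (P-∘ b φ tr) ⟩
        H._⇨_ X ⟦ a ⟧' ⟦ b ⟧'   ∎
        where open ≤-Reasoning X

proposition3p12 : ∀ {c ℓ₁ ℓ₂} (T : Tripos c ℓ₁ ℓ₂) (lem : (A : Set) → Dec A) →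
    let open Tripos T
        open Construction T lem
    in (imp : Sig × Sig → Sig) → IsImp imp →
       (mt : 𝔓 → Sig) → IsMeet mt →
       let open Ops imp mt
       in (X : Set) (a b : X → 𝒜) →
          HeytingAlgebra._≈_ (𝒫 X) ⟦ (λ x → a x ⇒ b x) ⟧' (HeytingAlgebra._⇨_ (𝒫 X) ⟦ a ⟧' ⟦ b ⟧')
proposition3p12 T lem imp imp-spec mt mt-spec X = ⟦⇒⟧'≈⇨ T lem imp imp-spec mt mt-spec
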